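{- Let $n\ge7$ and let $(1=a_1,a_2,\ldots,a_{n-1})$ be a two standard consecutive $(n-1)$-cycle with diagonal distance two. Suppose that for some $1\le i\le n-1$ the elements $(i-1)\bmod(n-1)$ and $(i+1)\bmod(n-1)$ (residues in $\{1,\ldots,n-1\}$) appear consecutively in the cycle, and $i\notin\{1,2,n-1,n-2\}$, i.e. $\{(i-1)\bmod(n-1),(i+1)\bmod(n-1)\}\notin\{\{1,n-2\},\{2,n-1\},\{1,3\},\{n-3,n-1\}\}$. If $n$ is inserted into the cycle at some position so that the resulting $n$-cycle is two standard consecutive, then the resulting $n$-cycle also has diagonal distance two.
   Context: An $m$-cycle written $(a_1=1,\ldots,a_m)$ is two standard consecutive if it is not $(1,\ldots,m)$ and for some $l$, $1,\ldots,l$ occur in increasing order left to right among $a_1,\ldots,a_m$, as do $l+1,\ldots,m$ (this $l$ is unique). Diagonal distance: let $S$ be the set of pairs $\{i,j\}$, $i\ne j$, with $j\not\equiv i\pm1\pmod m$, $i,j$ cyclically adjacent in the cycle, and one of $i,j$ in $\{1,\ldots,l\}$, the other in $\{l+1,\ldots,m\}$; the diagonal distance is $\min_{\{i,j\}\in S}\min\{(i-j)\bmod m,(j-i)\bmod m\}$ with residues in $\{0,\ldots,m-1\}$. -}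

module Defs where

open import Data.Nat using (ℕ; zero; suc; _+_; _∸_; _≤_; _<_; _⊓_; _≤?_; _<?_)
open import Data.Nat.DivMod using (_%_)
open import Data.List using (List; []; _∷_; _++_; [_]; map; upTo; filter; take; drop)
open import Data.List.Relation.Unary.Linked using (Linked)
open import Data.List.Relation.Binary.Permutation.Propositional using (_↭_)
open import Data.Product using (Σ; ∃; _×_)
open import Data.Sum using (_⊎_)
open import Relation.Nullary using (¬_)
open import Relation.Binary.PropositionalEquality using (_≡_; _≢_)

oneTo : ℕ → List ℕ
oneTo m = map suc (upTo m)

-- An m-cycle written (a_1 = 1, a_2, ..., a_m): a list that is a
-- permutation of 1..m and whose first entry is 1.
IsCycle : ℕ → List ℕ → Set
IsCycle m c = (c ↭ oneTo m) × (∃ λ t → c ≡ 1 ∷ t)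

SplitIncreasing : List ℕ → ℕ → Set
SplitIncreasing c l =
  Linked _<_ (filter (λ x → x ≤? l) c) × Linked _<_ (filter (λ x → l <? x) c)

TwoStdConsec : ℕ → List ℕ → Set
TwoStdConsec m c = IsCycle m c × (c ≢ oneTo m) × (∃ λ l → SplitIncreasing c l)

data CycAdj (c : List ℕ) : ℕ → ℕ → Set where
  inner : ∀ xs x y ys → c ≡ xs ++ x ∷ y ∷ ys → CycAdj c x y
  wrap  : ∀ x y mid → c ≡ y ∷ mid ++ [ x ] → CycAdj c x y

Consecutive : List ℕ → ℕ → ℕ → Set
Consecutive c x y = CycAdj c x y ⊎ CycAdj c y x

-- congruence modulo m (m = 0 is never used; defined as equality)
_≡[mod_]_ : ℕ → ℕ → ℕ → Set
a ≡[mod zero ] b = a ≡ b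
a ≡[mod suc k ] b = a % suc k ≡ b % suc k

-- min{(i-j) mod m, (j-i) mod m}, residues in {0,...,m-1}; i, j ≤ m
cycDist : ℕ → ℕ → ℕ → ℕ
cycDist zero i j = 0
cycDist (suc k) i j = ((i + suc k ∸ j) % suc k) ⊓ ((j + suc k ∸ i) % suc k)

-- residue of x modulo m taken in {1,...,m}
res : ℕ → ℕ → ℕ
res zero x = x
res (suc k) x = suc ((x + k) % suc k)

InS : ℕ → List ℕ → ℕ → ℕ → ℕ → Set
InS m c l i j =
  Consecutive c i j × i ≢ j
  × ¬ (j ≡[mod m ] (i + 1)) × ¬ ((j + 1) ≡[mod m ] i)
  × ((i ≤ l × l < j) ⊎ (j ≤ l × l < i))

DiagDistanceIs : ℕ → List ℕ → ℕ → ℕ → Set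
DiagDistanceIs m c l d =
  (∃ λ i → ∃ λ j → InS m c l i j × cycDist m i j ≡ d)
  × (∀ i j → InS m c l i j → d ≤ cycDist m i j)

-- c has diagonal distance d (l being the unique splitting value)
HasDiagDistance : ℕ → List ℕ → ℕ → Set
HasDiagDistance m c d = ∀ l → SplitIncreasing c l → DiagDistanceIs m c l d

-- insert x into c right after the k-th entry
insertAt : ℕ → ℕ → List ℕ → List ℕ
insertAt k x c = take k c ++ x ∷ drop k c

module Submission where

-- Write N = n, a = i - 1 and b = i + 1 = a + 2, and let L be the N-cycle
-- obtained by inserting N into c.  The hypotheses on i say exactly that
-- 2 ≤ a and b < N - 1; so neither a nor b is the head 1 of c, and
-- a, a + 1, b, N - 1, N are distinct values of L.
--
-- Lower bound: a pair of S consists of distinct values of 1..N that are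
-- not cyclic neighbours, so its cyclic distance is at least 2.  This holds
-- for every cycle and every split value l.
--
-- Attainment: {a, b} is a pair of S at cyclic distance 2.  The entries
-- ≤ l and the entries > l each occur in increasing order in L, so two
-- entries on one side of l with only entries of the other side between
-- them are adjacent values: no value of L lies strictly between them.
-- Hence N cannot have been inserted between a and b (N - 1 or a + 1 would
-- violate this), so a and b remain neighbours in L; and they cannot lie on
-- the same side of l, since a + 1 is a value between them.

open import Defs
open import Data.Empty using (⊥; ⊥-elim)
open import Data.List using (List; []; _∷_; _++_; [_]; filter)
open import Data.List.Membership.Propositional using (_∈_)
open import Data.List.Membership.Propositional.Properties
  using (∈-++⁺ʳ; ∈-filter⁺; ∈-map⁺; ∈-map⁻; ∈-upTo⁺; ∈-upTo⁻)
open import Data.List.Properties using (filter-++; filter-accept; filter-none; ++-assoc; ∷-injectiveˡ)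
open import Data.List.Relation.Binary.Permutation.Propositional using (_↭_; ↭-sym)
open import Data.List.Relation.Binary.Permutation.Propositional.Properties using (∈-resp-↭)
open import Data.List.Relation.Unary.All as All using (All; []; _∷_)
open import Data.List.Relation.Unary.AllPairs using (AllPairs; _∷_)
open import Data.List.Relation.Unary.Any using (here; there)
open import Data.List.Relation.Unary.Linked using (Linked)
open import Data.List.Relation.Unary.Linked.Properties using (Linked⇒AllPairs)
open import Data.Nat using (ℕ; zero; suc; _+_; _∸_; _⊓_; _≤_; _<_; z≤n; s≤s; _≤?_; _<?_)
open import Data.Nat.DivMod using (_%_; m<n⇒m%n≡m; [m+n]%n≡m%n)
open import Data.Nat.Properties
open import Data.Product using (∃; ∃₂; _×_; _,_; proj₁; proj₂) renaming (swap to ×-swap)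
open import Data.Sum using (_⊎_; inj₁; inj₂) renaming (swap to ⊎-swap)
open import Relation.Binary.Definitions using (tri<; tri≈; tri>)
open import Relation.Binary.PropositionalEquality
  using (_≡_; _≢_; refl; sym; trans; cong; cong₂; subst; subst₂; module ≡-Reasoning)
open import Relation.Nullary using (¬_; yes; no)
open import Relation.Unary using (Decidable; ∁)

AdjacentValues : List ℕ → ℕ → ℕ → Set
AdjacentValues L x y = x < y × (∀ {z} → z ∈ L → x < z → z < y → ⊥)

Between : ℕ → ℕ → ℕ → Set
Between x z y = (x < z × z < y) ⊎ (y < z × z < x)

Straddles : ℕ → ℕ → ℕ → Set
Straddles l x y = (x ≤ l × l < y) ⊎ (y ≤ l × l < x)

no-between : ∀ {L x y z} → AdjacentValues L x y → z ∈ L → Between x z y → ⊥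
no-between (_   , gap) z∈ (inj₁ (x<z , z<y)) = gap z∈ x<z z<y
no-between (x<y , _)   _  (inj₂ (y<z , z<x)) = <-asym x<y (<-trans y<z z<x)

sorted-adjacent : ∀ A {x y B} → AllPairs _<_ (A ++ x ∷ y ∷ B) → AdjacentValues (A ++ x ∷ y ∷ B) x y
sorted-adjacent A sorted = ordered A sorted , gap A sorted
  where
  ordered : ∀ A {x y B} → AllPairs _<_ (A ++ x ∷ y ∷ B) → x < y
  ordered []      ((x<y ∷ _) ∷ _) = x<y
  ordered (_ ∷ A) (_ ∷ sorted)   = ordered A sorted

  gap : ∀ A {x y B z} → AllPairs _<_ (A ++ x ∷ y ∷ B) → z ∈ A ++ x ∷ y ∷ B → x < z → z < y → ⊥
  gap []      _             (here refl)         x<z _   = <-irrefl refl x<z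
  gap []      _             (there (here refl)) _   z<y = <-irrefl refl z<y
  gap []      (_ ∷ y<B ∷ _) (there (there z∈B)) _   z<y = <-asym z<y (All.lookup y<B z∈B)
  gap (_ ∷ A) (a<rest ∷ _)  (here refl)         x<z _   = <-asym x<z (All.lookup a<rest (∈-++⁺ʳ A (here refl)))
  gap (_ ∷ A) (_ ∷ sorted)  (there z∈)          x<z z<y = gap A sorted z∈ x<z z<y

module _ {P : ℕ → Set} (P? : Decidable P) where

  filter-bridge : ∀ A {x} mid {y} B → P x → All (∁ P) mid → P y →
    filter P? (A ++ x ∷ mid ++ y ∷ B) ≡ filter P? A ++ x ∷ y ∷ filter P? B
  filter-bridge A {x} mid {y} B px ¬mid py = begin
    filter P? (A ++ x ∷ mid ++ y ∷ B)
      ≡⟨ filter-++ P? A _ ⟩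
    filter P? A ++ filter P? (x ∷ mid ++ y ∷ B)
      ≡⟨ cong (filter P? A ++_) (filter-accept P? px) ⟩
    filter P? A ++ x ∷ filter P? (mid ++ y ∷ B)
      ≡⟨ cong (λ r → filter P? A ++ x ∷ r) (filter-++ P? mid _) ⟩
    filter P? A ++ x ∷ filter P? mid ++ filter P? (y ∷ B)
      ≡⟨ cong₂ (λ u v → filter P? A ++ x ∷ u ++ v) (filter-none P? ¬mid) (filter-accept P? py) ⟩
    filter P? A ++ x ∷ y ∷ filter P? B ∎
    where open ≡-Reasoning

  filtered-adjacent : ∀ A {x} mid {y} B → P x → All (∁ P) mid → P y →
    Linked _<_ (filter P? (A ++ x ∷ mid ++ y ∷ B)) →
    x < y × (∀ {z} → z ∈ A ++ x ∷ mid ++ y ∷ B → P z → x < z → z < y → ⊥)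
  filtered-adjacent A {x} mid {y} B px ¬mid py increasing =
    proj₁ adjacent , λ z∈ pz → proj₂ adjacent (subst (_ ∈_) bridge (∈-filter⁺ P? z∈ pz))
    where
    bridge : filter P? (A ++ x ∷ mid ++ y ∷ B) ≡ filter P? A ++ x ∷ y ∷ filter P? B
    bridge = filter-bridge A mid B px ¬mid py
    adjacent : AdjacentValues (filter P? A ++ x ∷ y ∷ filter P? B) x y
    adjacent = sorted-adjacent (filter P? A) (Linked⇒AllPairs <-trans (subst (Linked _<_) bridge increasing))

gap-below : ∀ {L l} A {x} mid {y} B → SplitIncreasing L l → L ≡ A ++ x ∷ mid ++ y ∷ B →
  x ≤ l → All (l <_) mid → y ≤ l → AdjacentValues L x y
gap-below {l = l} A mid B (low , _) refl x≤l l<mid y≤l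
  with filtered-adjacent (λ z → z ≤? l) A mid B x≤l (All.map <⇒≱ l<mid) y≤l low
... | x<y , gap = x<y , λ z∈ x<z z<y → gap z∈ (≤-trans (<⇒≤ z<y) y≤l) x<z z<y

gap-above : ∀ {L l} A {x y} B → SplitIncreasing L l → L ≡ A ++ x ∷ y ∷ B →
  l < x → l < y → AdjacentValues L x y
gap-above {l = l} A B (_ , high) refl l<x l<y
  with filtered-adjacent (λ z → l <? z) A [] B l<x [] l<y high
... | x<y , gap = x<y , λ z∈ x<z z<y → gap z∈ (<-trans l<x x<z) x<z z<y

-- In a split list, neighbouring entries x, y with a value of L between
-- them lie on different sides of l: otherwise they would be adjacent values.
straddles : ∀ {L l} A {x y} B → SplitIncreasing L l → L ≡ A ++ x ∷ y ∷ B →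
  ∀ {z} → z ∈ L → Between x z y → Straddles l x y
straddles {l = l} A {x} {y} B split eq z∈ between with x ≤? l | y ≤? l
... | yes x≤l | no  y≰l = inj₁ (x≤l , ≰⇒> y≰l)
... | no  x≰l | yes y≤l = inj₂ (y≤l , ≰⇒> x≰l)
... | yes x≤l | yes y≤l = ⊥-elim (no-between (gap-below A [] B split eq x≤l [] y≤l) z∈ between)
... | no  x≰l | no  y≰l = ⊥-elim (no-between (gap-above A B split eq (≰⇒> x≰l) (≰⇒> y≰l)) z∈ between)

regroup : ∀ {L : List ℕ} A {x} rest → L ≡ A ++ x ∷ rest → L ≡ (A ++ [ x ]) ++ rest
regroup A rest eq = trans eq (sym (++-assoc A [ _ ] rest))

-- In a split list, a value top > y cannot sit between two neighbours x, y
-- if L has a value w with x < w < top and a value between x and y: if top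
-- and y share a side they would be decreasing neighbours; otherwise top is
-- above l and y below, and then x fails on either side.
no-bypass : ∀ {L l} A {x top y} B → SplitIncreasing L l → L ≡ A ++ x ∷ top ∷ y ∷ B → y < top →
  ∀ {w} → w ∈ L → x < w → w < top → ∀ {z} → z ∈ L → Between x z y → ⊥
no-bypass {l = l} A {x} {top} {y} B split eq y<top w∈ x<w w<top z∈ between with top ≤? l | y ≤? l
... | yes top≤l | _ =
  <-asym y<top (proj₁ (gap-below (A ++ [ x ]) [] B split (regroup A _ eq) top≤l [] (≤-trans (<⇒≤ y<top) top≤l)))
... | no top≰l | no y≰l =
  <-asym y<top (proj₁ (gap-above (A ++ [ x ]) B split (regroup A _ eq) (≰⇒> top≰l) (≰⇒> y≰l)))
... | no top≰l | yes y≤l with x ≤? l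
...   | yes x≤l = no-between (gap-below A [ top ] B split eq x≤l (≰⇒> top≰l ∷ []) y≤l) z∈ between
...   | no  x≰l = proj₂ (gap-above A (y ∷ B) split eq (≰⇒> x≰l) (≰⇒> top≰l)) w∈ x<w w<top

insertAt-neighbours : ∀ k z xs {x y} ys →
  (∃₂ λ A B → insertAt k z (xs ++ x ∷ y ∷ ys) ≡ A ++ x ∷ y ∷ B)
  ⊎ (∃₂ λ A B → insertAt k z (xs ++ x ∷ y ∷ ys) ≡ A ++ x ∷ z ∷ y ∷ B)
insertAt-neighbours zero          z xs       ys = inj₁ (z ∷ xs , ys , refl)
insertAt-neighbours (suc zero)    z []       ys = inj₂ ([] , ys , refl)
insertAt-neighbours (suc (suc k)) z []       ys = inj₁ ([] , insertAt k z ys , refl)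
insertAt-neighbours (suc k)       z (w ∷ xs) ys with insertAt-neighbours k z xs ys
... | inj₁ (A , B , eq) = inj₁ (w ∷ A , B , cong (w ∷_) eq)
... | inj₂ (A , B , eq) = inj₂ (w ∷ A , B , cong (w ∷_) eq)

inner-adjacent : ∀ {h t x y} → CycAdj (h ∷ t) x y → y ≢ h → ∃₂ λ xs ys → h ∷ t ≡ xs ++ x ∷ y ∷ ys
inner-adjacent (inner xs _ _ ys eq) _   = xs , ys , eq
inner-adjacent (wrap _ _ _ eq)      y≢h = ⊥-elim (y≢h (sym (∷-injectiveˡ eq)))

adjacent-after-insert : ∀ {l} k {top c} xs {x y} ys → c ≡ xs ++ x ∷ y ∷ ys →
  SplitIncreasing (insertAt k top c) l → y < top →
  ∀ {w} → w ∈ insertAt k top c → x < w → w < top →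
  ∀ {z} → z ∈ insertAt k top c → Between x z y →
  CycAdj (insertAt k top c) x y × Straddles l x y
adjacent-after-insert k xs ys refl split y<top w∈ x<w w<top z∈ between
  with insertAt-neighbours k _ xs ys
... | inj₁ (A , B , eq) = inner A _ _ B eq , straddles A B split eq z∈ between
... | inj₂ (A , B , eq) = ⊥-elim (no-bypass A B split eq y<top w∈ x<w w<top z∈ between)

consecutive-after-insert : ∀ {l} k {top h t x y} → Consecutive (h ∷ t) x y → x ≢ h → y ≢ h →
  SplitIncreasing (insertAt k top (h ∷ t)) l → x < top → y < top →
  ∀ {w} → w ∈ insertAt k top (h ∷ t) → x < w → y < w → w < top →
  ∀ {z} → z ∈ insertAt k top (h ∷ t) → Between x z y →
  Consecutive (insertAt k top (h ∷ t)) x y × Straddles l x y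
consecutive-after-insert k (inj₁ adj) _ y≢h split _ y<top w∈ x<w _ w<top z∈ between
  with inner-adjacent adj y≢h
... | xs , ys , eq with adjacent-after-insert k xs ys eq split y<top w∈ x<w w<top z∈ between
...   | adj′ , straddle = inj₁ adj′ , straddle
consecutive-after-insert k (inj₂ adj) x≢h _ split x<top _ w∈ _ y<w w<top z∈ between
  with inner-adjacent adj x≢h
... | xs , ys , eq with adjacent-after-insert k xs ys eq split x<top w∈ y<w w<top z∈ (⊎-swap between)
...   | adj′ , straddle = inj₂ adj′ , ⊎-swap straddle

∈-oneTo⁺ : ∀ {N z} → 1 ≤ z → z ≤ N → z ∈ oneTo N
∈-oneTo⁺ {z = suc z} _ z≤N = ∈-map⁺ suc (∈-upTo⁺ z≤N)

∈-oneTo⁻ : ∀ {N z} → z ∈ oneTo N → 1 ≤ z × z ≤ N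
∈-oneTo⁻ z∈ with ∈-map⁻ suc z∈
... | _ , z′∈ , refl = s≤s z≤n , ∈-upTo⁻ z′∈

cycAdj-∈ : ∀ {L x y} → CycAdj L x y → x ∈ L × y ∈ L
cycAdj-∈ (inner xs _ _ _ refl) = ∈-++⁺ʳ xs (here refl) , ∈-++⁺ʳ xs (there (here refl))
cycAdj-∈ (wrap _ _ mid refl)   = there (∈-++⁺ʳ mid (here refl)) , here refl

consecutive-∈ : ∀ {L x y} → Consecutive L x y → x ∈ L × y ∈ L
consecutive-∈ (inj₁ adj) = cycAdj-∈ adj
consecutive-∈ (inj₂ adj) = ×-swap (cycAdj-∈ adj)

cycDist-sym : ∀ N i j → cycDist N i j ≡ cycDist N j i
cycDist-sym zero    _ _ = refl
cycDist-sym (suc M) i j = ⊓-comm _ _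

cycDist-offset : ∀ M i d → 0 < d → d < suc M → cycDist (suc M) i (i + d) ≡ (suc M ∸ d) ⊓ d
cycDist-offset M i d 0<d d<N = cong₂ _⊓_ backward forward
  where
  open ≡-Reasoning
  backward : (i + suc M ∸ (i + d)) % suc M ≡ suc M ∸ d
  backward = begin
    (i + suc M ∸ (i + d)) % suc M ≡⟨ cong (_% suc M) ([m+n]∸[m+o]≡n∸o i (suc M) d) ⟩
    (suc M ∸ d) % suc M           ≡⟨ m<n⇒m%n≡m (∸-monoʳ-< 0<d (<⇒≤ d<N)) ⟩
    suc M ∸ d                     ∎
  forward : (i + d + suc M ∸ i) % suc M ≡ d
  forward = begin
    (i + d + suc M ∸ i) % suc M   ≡⟨ cong (λ s → (s ∸ i) % suc M) (+-assoc i d (suc M)) ⟩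
    (i + (d + suc M) ∸ i) % suc M ≡⟨ cong (_% suc M) (m+n∸m≡n i (d + suc M)) ⟩
    (d + suc M) % suc M           ≡⟨ [m+n]%n≡m%n d (suc M) ⟩
    d % suc M                     ≡⟨ m<n⇒m%n≡m d<N ⟩
    d                             ∎

offset-bound : ∀ {N} i d → 1 ≤ i → i + d ≤ N → ¬ (i ≡ 1 × i + d ≡ N) → 2 + d ≤ N
offset-bound (suc zero)    d _ 1+d≤N not-ends = ≤∧≢⇒< 1+d≤N (λ e → not-ends (refl , e))
offset-bound (suc (suc i)) d _ i+d≤N _        = ≤-trans (s≤s (s≤s (m≤n+m d i))) i+d≤N

cycDist-offset-lower : ∀ M i d → 1 ≤ i → i + d ≤ suc M → 2 ≤ d → ¬ (i ≡ 1 × i + d ≡ suc M) →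
  2 ≤ cycDist (suc M) i (i + d)
cycDist-offset-lower M i d 1≤i i+d≤N 2≤d not-ends =
  subst (2 ≤_) (sym (cycDist-offset M i d (<-≤-trans (s≤s z≤n) 2≤d) d<N))
    (⊓-glb (m+n≤o⇒m≤o∸n 2 2+d≤N) 2≤d)
  where
  2+d≤N : 2 + d ≤ suc M
  2+d≤N = offset-bound i d 1≤i i+d≤N not-ends
  d<N : d < suc M
  d<N = ≤-trans (n≤1+n (suc d)) 2+d≤N

cycDist-lower-< : ∀ M {i j} → i < j → 1 ≤ i → j ≤ suc M →
  ¬ (j ≡[mod suc M ] (i + 1)) → ¬ ((j + 1) ≡[mod suc M ] i) → 2 ≤ cycDist (suc M) i j
cycDist-lower-< M {i} {j} i<j 1≤i j≤N not-next not-wrap with j ∸ i | m+[n∸m]≡n (<⇒≤ i<j)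
... | zero        | i+0≡j = ⊥-elim (<-irrefl (trans (sym (+-identityʳ i)) i+0≡j) i<j)
... | suc zero    | i+1≡j = ⊥-elim (not-next (cong (_% suc M) (sym i+1≡j)))
... | suc (suc d) | refl  = cycDist-offset-lower M i (2 + d) 1≤i j≤N (s≤s (s≤s z≤n)) not-ends
  where
  -- for i = 1, j = N the values j + 1 and i are congruent
  not-ends : ¬ (i ≡ 1 × i + (2 + d) ≡ suc M)
  not-ends (refl , j≡N) = not-wrap (begin
    (1 + (2 + d) + 1) % suc M ≡⟨ cong (λ s → (s + 1) % suc M) j≡N ⟩
    (suc M + 1) % suc M       ≡⟨ cong (_% suc M) (+-comm (suc M) 1) ⟩
    (1 + suc M) % suc M       ≡⟨ [m+n]%n≡m%n 1 (suc M) ⟩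
    1 % suc M                 ∎)
    where open ≡-Reasoning

cycDist-lower : ∀ M {i j} → 1 ≤ i → i ≤ suc M → 1 ≤ j → j ≤ suc M → i ≢ j →
  ¬ (j ≡[mod suc M ] (i + 1)) → ¬ ((j + 1) ≡[mod suc M ] i) → 2 ≤ cycDist (suc M) i j
cycDist-lower M {i} {j} 1≤i i≤N 1≤j j≤N i≢j not-next not-wrap with <-cmp i j
... | tri< i<j _   _ = cycDist-lower-< M i<j 1≤i j≤N not-next not-wrap
... | tri≈ _ i≡j   _ = ⊥-elim (i≢j i≡j)
... | tri> _   _ j<i = subst (2 ≤_) (cycDist-sym (suc M) j i)
  (cycDist-lower-< M j<i 1≤j i≤N (λ e → not-wrap (sym e)) (λ e → not-next (sym e)))

S-lower-bound : ∀ {M L l i j} → L ↭ oneTo (suc M) → InS (suc M) L l i j → 2 ≤ cycDist (suc M) i j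
S-lower-bound {M} perm (consecutive , i≢j , not-next , not-wrap , _)
  with consecutive-∈ consecutive
... | i∈ , j∈ with ∈-oneTo⁻ (∈-resp-↭ perm i∈) | ∈-oneTo⁻ (∈-resp-↭ perm j∈)
...   | 1≤i , i≤N | 1≤j , j≤N = cycDist-lower M 1≤i i≤N 1≤j j≤N i≢j not-next not-wrap

≢⇒≢[mod] : ∀ M {x y} → x < suc M → y < suc M → x ≢ y → ¬ (x ≡[mod suc M ] y)
≢⇒≢[mod] M x<N y<N x≢y x≡y = x≢y (trans (sym (m<n⇒m%n≡m x<N)) (trans x≡y (m<n⇒m%n≡m y<N)))

module _ {m a : ℕ} (3+a≤m : 3 + a ≤ m) where

  pair-not-neighbours : a ≢ 2 + a × ¬ ((2 + a) ≡[mod suc m ] (a + 1)) × ¬ ((2 + a + 1) ≡[mod suc m ] a)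
  pair-not-neighbours =
      m≢1+n+m a {1}
    , ≢⇒≢[mod] m (s≤s (<⇒≤ 3+a≤m)) (s≤s (≤-trans (≤-reflexive a+1≡1+a) a<m))
        (λ e → m≢1+n+m (suc a) {0} (sym (trans e a+1≡1+a)))
    , ≢⇒≢[mod] m (s≤s (≤-trans (≤-reflexive (cong (2 +_) a+1≡1+a)) 3+a≤m)) (s≤s (<⇒≤ a<m))
        (λ e → m≢1+n+m a {2} (trans (sym e) (cong (2 +_) a+1≡1+a)))
    where
    a+1≡1+a : a + 1 ≡ suc a
    a+1≡1+a = +-comm a 1
    a<m : a < m
    a<m = ≤-trans (m≤n+m (suc a) 2) 3+a≤m

  pair-distance : cycDist (suc m) a (2 + a) ≡ 2
  pair-distance = begin
    cycDist (suc m) a (2 + a) ≡⟨ cong (cycDist (suc m) a) (+-comm 2 a) ⟩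
    cycDist (suc m) a (a + 2) ≡⟨ cycDist-offset m a 2 (s≤s z≤n) (≤-trans (s≤s (s≤s (s≤s z≤n))) 4≤N) ⟩
    (suc m ∸ 2) ⊓ 2           ≡⟨ m≥n⇒m⊓n≡n (m+n≤o⇒m≤o∸n 2 4≤N) ⟩
    2                         ∎
    where
    open ≡-Reasoning
    4≤N : 4 ≤ suc m
    4≤N = s≤s (≤-trans (m≤m+n 3 a) 3+a≤m)

-- Attainment: if a and a + 2 (2 ≤ a, a + 3 ≤ m) are consecutive in the
-- cycle 1 ∷ t and inserting m + 1 yields a cycle L, then for every split
-- value l of L the pair {a, a + 2} belongs to S and is at distance 2.
-- In consecutive-after-insert, the values m and a + 1 of L serve as w and z.
pair-witness : ∀ {m a t l} k → 2 ≤ a → 3 + a ≤ m → Consecutive (1 ∷ t) a (2 + a) →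
  insertAt k (suc m) (1 ∷ t) ↭ oneTo (suc m) → SplitIncreasing (insertAt k (suc m) (1 ∷ t)) l →
  InS (suc m) (insertAt k (suc m) (1 ∷ t)) l a (2 + a) × cycDist (suc m) a (2 + a) ≡ 2
pair-witness {m} {a} {t} {l} k 2≤a 3+a≤m consecutive perm split =
  let consecutive′ , straddle = kept
      a≢b , not-next , not-wrap = pair-not-neighbours 3+a≤m
  in (consecutive′ , a≢b , not-next , not-wrap , straddle) , pair-distance 3+a≤m
  where
  a<m : a < m
  a<m = ≤-trans (m≤n+m (suc a) 2) 3+a≤m
  a≢1 : a ≢ 1
  a≢1 a≡1 = <⇒≢ 2≤a (sym a≡1)
  in-cycle : ∀ {z} → 1 ≤ z → z ≤ suc m → z ∈ insertAt k (suc m) (1 ∷ t)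
  in-cycle 1≤z z≤N = ∈-resp-↭ (↭-sym perm) (∈-oneTo⁺ 1≤z z≤N)
  kept : Consecutive (insertAt k (suc m) (1 ∷ t)) a (2 + a) × Straddles l a (2 + a)
  kept = consecutive-after-insert k consecutive a≢1 (λ ()) split
    (s≤s (<⇒≤ a<m)) (s≤s (<⇒≤ 3+a≤m))
    (in-cycle (≤-trans (s≤s z≤n) 3+a≤m) (n≤1+n m)) a<m 3+a≤m (n<1+n m)
    (in-cycle (s≤s z≤n) (s≤s (<⇒≤ a<m)))
    (inj₁ (n<1+n a , n<1+n (suc a)))

diagonal-distance-two : ∀ {m a t} k → 2 ≤ a → 3 + a ≤ m → Consecutive (1 ∷ t) a (2 + a) →
  insertAt k (suc m) (1 ∷ t) ↭ oneTo (suc m) → HasDiagDistance (suc m) (insertAt k (suc m) (1 ∷ t)) 2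
diagonal-distance-two {a = a} k 2≤a 3+a≤m consecutive perm _ split =
    (a , 2 + a , pair-witness k 2≤a 3+a≤m consecutive perm split)
  , λ _ _ → S-lower-bound perm

res-id : ∀ m {x} → 1 ≤ x → x ≤ m → res m x ≡ x
res-id zero    _ _ = refl
res-id (suc k) {suc x} _ (s≤s x≤k) = cong suc (begin
  (suc x + k) % suc k ≡⟨ cong (_% suc k) (sym (+-suc x k)) ⟩
  (x + suc k) % suc k ≡⟨ [m+n]%n≡m%n x (suc k) ⟩
  x % suc k           ≡⟨ m<n⇒m%n≡m (s≤s x≤k) ⟩
  x                   ∎)
  where open ≡-Reasoning

interior-index : ∀ {m} i → 1 ≤ i → i ≤ m → i ≢ 1 → i ≢ 2 → i ≢ m → i ≢ m ∸ 1 →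
  ∃ λ a → i ≡ suc a × 2 ≤ a × 3 + a ≤ m
interior-index (suc zero)          _ _   i≢1 _   _   _     = ⊥-elim (i≢1 refl)
interior-index (suc (suc zero))    _ _   _   i≢2 _   _     = ⊥-elim (i≢2 refl)
interior-index (suc (suc (suc a))) _ i≤m _   _   i≢m i≢m-1 =
  suc (suc a) , refl , s≤s (s≤s z≤n) , ≤∧≢⇒< (≤∧≢⇒< i≤m i≢m) (λ e → i≢m-1 (cong (_∸ 1) e))

mainTheorem9 : (n : ℕ) → 7 ≤ n → (c : List ℕ) → TwoStdConsec (n ∸ 1) c
    → HasDiagDistance (n ∸ 1) c 2
    → (i : ℕ) → 1 ≤ i → i ≤ n ∸ 1
    → Consecutive c (res (n ∸ 1) (i ∸ 1)) (res (n ∸ 1) (suc i))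
    → i ≢ 1 → i ≢ 2 → i ≢ n ∸ 1 → i ≢ n ∸ 2
    → (k : ℕ) → 1 ≤ k → k ≤ n ∸ 1
    → TwoStdConsec n (insertAt k n c)
    → HasDiagDistance n (insertAt k n c) 2
mainTheorem9 (suc m) _ _ ((_ , t , refl) , _) _ i 1≤i i≤m consecutive i≢1 i≢2 i≢m i≢m-1 k _ _ ((perm , _) , _)
  with interior-index i 1≤i i≤m i≢1 i≢2 i≢m i≢m-1
... | a , refl , 2≤a , 3+a≤m =
  diagonal-distance-two k 2≤a 3+a≤m
    (subst₂ (Consecutive (1 ∷ t)) (res-id m (<⇒≤ 2≤a) a≤m) (res-id m (s≤s z≤n) 2+a≤m) consecutive) perm
  where
  a≤m : a ≤ m
  a≤m = ≤-trans (m≤n+m a 3) 3+a≤m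
  2+a≤m : 2 + a ≤ m
  2+a≤m = ≤-trans (n≤1+n (2 + a)) 3+a≤m
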